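{- Let $\ell\geq5$ and $Q\geq5$ be distinct primes and let $a_0,b_0$ be integers with $Q\nmid a_0b_0$. Let $\psi(x)=e^{2\pi i x/Q}$ and $$\mathrm K_2(\psi^{b_0},a_0)=\sum_{\substack{x_1,x_2\bmod Q\\ x_1x_2\equiv a_0\ (\mathrm{mod}\ Q)}}\psi^{b_0}(x_1+x_2).$$ If $\mathrm K_2(\psi^{b_0},a_0)\equiv0\pmod\ell$ (i.e. $\mathrm K_2(\psi^{b_0},a_0)\in\ell\,\mathbb{Z}[e^{2\pi i/Q}]$), then $Q\equiv\pm1\pmod\ell$.
   Context: $\psi^{b}(x)$ means $\psi(x)^b=e^{2\pi i bx/Q}$. -}

module Defs where

open import Data.Nat as ℕ using (ℕ; zero; suc; NonZero; _≡ᵇ_)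
open import Data.Nat.DivMod using (m%n<n)
open import Data.Fin as F using (Fin; toℕ; fromℕ<)
open import Data.Integer as ℤ using (ℤ; +_; _%ℕ_)
open import Data.Bool using (if_then_else_; _∧_)
open import Data.Product using (Σ; ∃)
open import Relation.Binary.PropositionalEquality using (_≡_)

finSum : (n : ℕ) → (Fin n → ℤ) → ℤ
finSum zero    f = + 0
finSum (suc n) f = f F.zero ℤ.+ finSum n (λ i → f (F.suc i))

-- The integral group ring ℤ[C_Q] ≅ ℤ[x]/(x^Q - 1): the element Σ_k f(k) x^k
-- is represented by its coefficient function f : Fin Q → ℤ.
ZC : ℕ → Set
ZC Q = Fin Q → ℤ

subMod : (Q : ℕ) .{{_ : NonZero Q}} → Fin Q → Fin Q → Fin Q
subMod Q k i = fromℕ< (m%n<n (Q ℕ.+ toℕ k ℕ.∸ toℕ i) Q)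

_⊛_ : {Q : ℕ} .{{_ : NonZero Q}} → ZC Q → ZC Q → ZC Q
_⊛_ {Q} f g k = finSum Q (λ i → f i ℤ.* g (subMod Q k i))

-- The norm element N = 1 + x + ... + x^(Q-1) = Φ_Q(x) (Q prime).
normElt : (Q : ℕ) → ZC Q
normElt Q _ = + 1

-- ℤ[e^{2πi/Q}] ≅ ℤ[x]/(Φ_Q(x)) ≅ ℤ[C_Q]/(N)  (Q prime), with e^{2πi/Q} ↦ x.
-- "f ∈ ℓ · ℤ[ζ_Q]" for the image of f ∈ ℤ[C_Q]:
-- f = ℓ·y + N·z for some y, z ∈ ℤ[C_Q].
InLZeta : (Q : ℕ) .{{_ : NonZero Q}} → ℕ → ZC Q → Set
InLZeta Q ℓ f = Σ (ZC Q) λ y → Σ (ZC Q) λ z →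
  ∀ k → f k ≡ (+ ℓ) ℤ.* y k ℤ.+ (normElt Q ⊛ z) k

-- Kloosterman sum K₂(ψ^{b₀}, a₀) = Σ_{x₁x₂ ≡ a₀ (Q)} ψ^{b₀}(x₁ + x₂), where
-- ψ^{b₀}(x) = ζ^{b₀ x} and ζ^j ↦ x^(j mod Q).
K2 : (Q : ℕ) .{{_ : NonZero Q}} → (b₀ a₀ : ℤ) → ZC Q
K2 Q b₀ a₀ k = finSum Q λ x₁ → finSum Q λ x₂ →
  if ((((+ toℕ x₁) ℤ.* (+ toℕ x₂) ℤ.- a₀) %ℕ Q) ≡ᵇ 0)
     ∧ (((b₀ ℤ.* ((+ toℕ x₁) ℤ.+ (+ toℕ x₂))) %ℕ Q) ≡ᵇ toℕ k)
  then + 1 else + 0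

{-# OPTIONS --safe #-}

-- In ℤ[C_Q] every coefficient of N ⊛ z equals Σ z, so K₂ = ℓ y + N z says that each
-- coefficient of K₂ is ℓ y_k + W for a single integer W. These coefficients are
-- nonnegative and add up to the number Q − 1 of solutions of x₁ x₂ ≡ a₀, so one of them
-- vanishes; comparing Q − 1 = ℓ Σ y + Q W with 0 = ℓ y_k + W gives ℓ ∣ Q − 1.

module Submission where

module Lemmas where

  open import Defs
  open import Data.Bool using (Bool; true; false; if_then_else_; _∧_; T)
  open import Data.Fin using (Fin; zero; suc; toℕ; fromℕ<; punchIn)
  open import Data.Fin.Permutation using (permutation)
  open import Data.Fin.Properties using (toℕ-injective; toℕ<n; toℕ-fromℕ<; punchInᵢ≢i; all?; ¬∀⟶∃¬)
  open import Data.Integer as ℤ using (ℤ; +_; _+_; _-_; -_; _*_; 0ℤ; 1ℤ; _%ℕ_; _/ℕ_; _≤_; _<_; +≤+; ∣_∣; _⊖_)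
  open import Data.Integer.DivMod using (a≡a%ℕn+[a/ℕn]*n; n%ℕd<d)
  open import Data.Integer.Divisibility using (_∣_)
  open import Data.Integer.Divisibility.Signed
    using (divides; ∣⇒∣ᵤ; ∣m∣n⇒∣m+n; ∣m∣n⇒∣m-n; ∣n⇒∣m*n; ∣m⇒∣-m)
    renaming (_∣_ to _∣ₛ_)
  import Data.Integer.Properties as ℤₚ
  open import Data.Integer.Tactic.RingSolver using (solve-∀)
  open import Data.Nat as ℕ using (ℕ; zero; suc; _∸_; _≡ᵇ_; NonZero)
  open import Data.Nat.Coprimality using (Coprime; coprime-Bézout; coprime-divisor; prime⇒coprime)
  open import Data.Nat.DivMod using (_%_; _/_; m≡m%n+[m/n]*n; [m+kn]%n≡m%n; m<n⇒m%n≡m; m%n<n)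
  open import Data.Nat.Divisibility as ND using (n∣m⇒m%n≡0)
  open import Data.Nat.GCD using (module Bézout)
  open import Data.Nat.Primality using (Prime)
  import Data.Nat.Properties as ℕₚ
  open import Data.Nat.Tactic.RingSolver using () renaming (solve-∀ to ℕ-solve-∀)
  open import Data.Product using (∃; _,_; proj₁; proj₂)
  open import Data.Sum using (inj₁; inj₂)
  open import Data.Unit using (tt)
  open import Function using (_∘_)
  open import Relation.Nullary using (¬_; yes; no; contradiction)
  open import Relation.Binary.PropositionalEquality
    using (_≡_; refl; sym; trans; cong; cong₂; subst; module ≡-Reasoning)
  open import Algebra.Properties.Semiring.Sum ℤₚ.+-*-semiring
    using (sum; sum-cong-≗; sum-replicate-zero; sum-remove; sum-permute; ∑-comm; ∑-distrib-+; *-distribˡ-sum)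

  open ≡-Reasoning

  𝟙 : Bool → ℤ
  𝟙 b = if b then 1ℤ else 0ℤ

  𝟙-T : ∀ {b} → T b → 𝟙 b ≡ 1ℤ
  𝟙-T {true} _ = refl

  𝟙-¬T : ∀ {b} → ¬ T b → 𝟙 b ≡ 0ℤ
  𝟙-¬T {true}  ¬t = contradiction tt ¬t
  𝟙-¬T {false} _  = refl

  finSum≡sum : ∀ n (f : Fin n → ℤ) → finSum n f ≡ sum f
  finSum≡sum zero    f = refl
  finSum≡sum (suc n) f = cong (_+_ (f zero)) (finSum≡sum n (f ∘ suc))

  sum-const : ∀ n c → sum {n} (λ _ → c) ≡ + n * c
  sum-const zero    c = refl
  sum-const (suc n) c = begin
    c + sum {n} (λ _ → c) ≡⟨ cong (_+_ c) (sum-const n c) ⟩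
    c + + n * c           ≡⟨ distrib c (+ n) ⟩
    (1ℤ + + n) * c        ∎
    where
    distrib : ∀ c m → c + m * c ≡ (1ℤ + m) * c
    distrib = solve-∀

  sum-𝟙-none : ∀ {n} (p : Fin n → Bool) → (∀ i → ¬ T (p i)) → sum (𝟙 ∘ p) ≡ 0ℤ
  sum-𝟙-none {n} p ¬p = trans (sum-cong-≗ (𝟙-¬T ∘ ¬p)) (sum-replicate-zero n)

  sum-𝟙-unique : ∀ {n} (p : Fin n → Bool) {j} → T (p j) → (∀ i → T (p i) → i ≡ j) →
    sum (𝟙 ∘ p) ≡ 1ℤ
  sum-𝟙-unique {suc _} p {j} pj unique = begin
    sum (𝟙 ∘ p)                                ≡⟨ sum-remove {i = j} (𝟙 ∘ p) ⟩
    𝟙 (p j) + sum (𝟙 ∘ p ∘ punchIn j)          ≡⟨ cong₂ _+_ (𝟙-T pj) (sum-𝟙-none (p ∘ punchIn j) ¬p) ⟩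
    1ℤ + 0ℤ                                    ∎
    where
    ¬p : ∀ i → ¬ T (p (punchIn j i))
    ¬p i = punchInᵢ≢i j i ∘ unique (punchIn j i)

  sum-𝟙-≡ᵇ : ∀ {n m} → m ℕ.< n → sum (λ (k : Fin n) → 𝟙 (m ≡ᵇ toℕ k)) ≡ 1ℤ
  sum-𝟙-≡ᵇ {m = m} m<n = sum-𝟙-unique (λ k → m ≡ᵇ toℕ k) hit unique
    where
    hit : T (m ≡ᵇ toℕ (fromℕ< m<n))
    hit = ℕₚ.≡⇒≡ᵇ m _ (sym (toℕ-fromℕ< m<n))
    unique : ∀ k → T (m ≡ᵇ toℕ k) → k ≡ fromℕ< m<n
    unique k m≡k = toℕ-injective (trans (sym (ℕₚ.≡ᵇ⇒≡ m _ m≡k)) (sym (toℕ-fromℕ< m<n)))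

  sum-𝟙-∧ : ∀ {n} c (p : Fin n → Bool) → sum (𝟙 ∘ p) ≡ 1ℤ → sum (λ k → 𝟙 (c ∧ p k)) ≡ 𝟙 c
  sum-𝟙-∧ true  p sum≡1 = sum≡1
  sum-𝟙-∧ {n} false p _ = sum-replicate-zero n

  0≤sum : ∀ {n} (f : Fin n → ℤ) → (∀ i → 0ℤ ≤ f i) → 0ℤ ≤ sum f
  0≤sum {zero}  f f≥0 = ℤₚ.≤-refl
  0≤sum {suc n} f f≥0 = ℤₚ.+-mono-≤ (f≥0 zero) (0≤sum (f ∘ suc) (f≥0 ∘ suc))

  n≤sum : ∀ {n} (f : Fin n → ℤ) → (∀ i → 1ℤ ≤ f i) → + n ≤ sum f
  n≤sum {zero}  f f≥1 = ℤₚ.≤-refl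
  n≤sum {suc n} f f≥1 = ℤₚ.+-mono-≤ (f≥1 zero) (n≤sum (f ∘ suc) (f≥1 ∘ suc))

  sum<n⇒∃≡0 : ∀ {n} (f : Fin n → ℤ) → (∀ i → 0ℤ ≤ f i) → sum f < + n → ∃ λ i → f i ≡ 0ℤ
  sum<n⇒∃≡0 {n} f f≥0 sum<n with all? (λ i → 1ℤ ℤₚ.≤? f i)
  ... | yes f≥1 = contradiction (n≤sum f f≥1) (ℤₚ.<⇒≱ sum<n)
  ... | no ¬f≥1 with ¬∀⟶∃¬ n (λ i → 1ℤ ≤ f i) (λ i → 1ℤ ℤₚ.≤? f i) ¬f≥1
  ...   | i , fi≱1 = i , ≡0 (f≥0 i) fi≱1
    where
    ≡0 : ∀ {x} → 0ℤ ≤ x → ¬ 1ℤ ≤ x → x ≡ 0ℤ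
    ≡0 {+ zero}  _ _   = refl
    ≡0 {+ suc _} _ x≱1 = contradiction (+≤+ (ℕ.s≤s ℕ.z≤n)) x≱1

  ∣+m-+n∣≡∣m-n∣ : ∀ m n → ∣ + m - + n ∣ ≡ ℕ.∣ m - n ∣
  ∣+m-+n∣≡∣m-n∣ m n with ℕₚ.≤-total m n
  ... | inj₁ m≤n = begin
    ∣ + m - + n ∣ ≡⟨ cong ∣_∣ (ℤₚ.m-n≡m⊖n m n) ⟩
    ∣ m ⊖ n ∣     ≡⟨ ℤₚ.∣⊖∣-≤ m≤n ⟩
    n ∸ m         ≡⟨ ℕₚ.m≤n⇒∣m-n∣≡n∸m m≤n ⟨
    ℕ.∣ m - n ∣   ∎
  ... | inj₂ n≤m = begin
    ∣ + m - + n ∣ ≡⟨ cong ∣_∣ (ℤₚ.m-n≡m⊖n m n) ⟩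
    ∣ m ⊖ n ∣     ≡⟨ ℤₚ.∣m⊖n∣≡∣n⊖m∣ m n ⟩
    ∣ n ⊖ m ∣     ≡⟨ ℤₚ.∣⊖∣-≤ n≤m ⟩
    m ∸ n         ≡⟨ ℕₚ.m≤n⇒∣n-m∣≡n∸m n≤m ⟨
    ℕ.∣ m - n ∣   ∎

  1+m*n≡o*p⇒ℤ : ∀ a b c d → 1 ℕ.+ a ℕ.* b ≡ c ℕ.* d → 1ℤ + + a * + b ≡ + c * + d
  1+m*n≡o*p⇒ℤ a b c d eq = begin
    1ℤ + + a * + b      ≡⟨ cong (_+_ 1ℤ) (ℤₚ.pos-* a b) ⟨
    + (1 ℕ.+ a ℕ.* b)   ≡⟨ cong +_ eq ⟩
    + (c ℕ.* d)         ≡⟨ ℤₚ.pos-* c d ⟩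
    + c * + d           ∎

  [m∸[m∸i]%n]%n≡i : ∀ {m i} n .{{_ : NonZero n}} → n ℕ.≤ m → i ℕ.< n → (m ∸ (m ∸ i) % n) % n ≡ i
  [m∸[m∸i]%n]%n≡i {m} {i} n n≤m i<n = begin
    (m ∸ r) % n               ≡⟨ cong (_% n) (ℕₚ.+-cancelʳ-≡ r _ _ key) ⟩
    (i ℕ.+ q ℕ.* n) % n       ≡⟨ [m+kn]%n≡m%n i q n ⟩
    i % n                     ≡⟨ m<n⇒m%n≡m i<n ⟩
    i                         ∎
    where
    r q : ℕ
    r = (m ∸ i) % n
    q = (m ∸ i) / n
    key : m ∸ r ℕ.+ r ≡ i ℕ.+ q ℕ.* n ℕ.+ r
    key = begin
      m ∸ r ℕ.+ r             ≡⟨ ℕₚ.m∸n+n≡m (ℕₚ.≤-trans (ℕₚ.<⇒≤ (m%n<n (m ∸ i) n)) n≤m) ⟩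
      m                       ≡⟨ ℕₚ.m∸n+n≡m (ℕₚ.≤-trans (ℕₚ.<⇒≤ i<n) n≤m) ⟨
      m ∸ i ℕ.+ i             ≡⟨ cong (ℕ._+ i) (m≡m%n+[m/n]*n (m ∸ i) n) ⟩
      r ℕ.+ q ℕ.* n ℕ.+ i     ≡⟨ ℕ-solve r (q ℕ.* n) i ⟩
      i ℕ.+ q ℕ.* n ℕ.+ r     ∎
      where
      ℕ-solve : ∀ a b c → a ℕ.+ b ℕ.+ c ≡ c ℕ.+ b ℕ.+ a
      ℕ-solve = ℕ-solve-∀

  module _ {Q : ℕ} .{{_ : NonZero Q}} where

    ∣∧<⇒≡0 : ∀ {m} → Q ND.∣ m → m ℕ.< Q → m ≡ 0
    ∣∧<⇒≡0 {m} Q∣m m<Q = trans (sym (m<n⇒m%n≡m m<Q)) (n∣m⇒m%n≡0 m Q Q∣m)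

    ∣-%ℕ : ∀ x → + Q ∣ₛ x - + (x %ℕ Q)
    ∣-%ℕ x = divides (x /ℕ Q) (begin
      x - + (x %ℕ Q)                           ≡⟨ cong (_- + (x %ℕ Q)) (a≡a%ℕn+[a/ℕn]*n x Q) ⟩
      + (x %ℕ Q) + x /ℕ Q * + Q - + (x %ℕ Q)   ≡⟨ cancel (+ (x %ℕ Q)) (x /ℕ Q * + Q) ⟩
      x /ℕ Q * + Q                             ∎)
      where
      cancel : ∀ r s → r + s - r ≡ s
      cancel = solve-∀

    T[%ℕ≡ᵇ0]⇒∣ : ∀ x → T (x %ℕ Q ≡ᵇ 0) → + Q ∣ₛ x
    T[%ℕ≡ᵇ0]⇒∣ x r≡0 = subst (+ Q ∣ₛ_) x-0≡x (∣-%ℕ x)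
      where
      x-0≡x : x - + (x %ℕ Q) ≡ x
      x-0≡x = trans (cong (λ r → x - + r) (ℕₚ.≡ᵇ⇒≡ _ 0 r≡0)) (ℤₚ.+-identityʳ x)

    ∣⇒T[%ℕ≡ᵇ0] : ∀ x → + Q ∣ₛ x → T (x %ℕ Q ≡ᵇ 0)
    ∣⇒T[%ℕ≡ᵇ0] x Q∣x = ℕₚ.≡⇒≡ᵇ _ 0 (∣∧<⇒≡0 (∣⇒∣ᵤ Q∣r) (n%ℕd<d x Q))
      where
      cancel : ∀ x r → x - (x - r) ≡ r
      cancel = solve-∀
      Q∣r : + Q ∣ₛ + (x %ℕ Q)
      Q∣r = subst (+ Q ∣ₛ_) (cancel x (+ (x %ℕ Q))) (∣m∣n⇒∣m-n Q∣x (∣-%ℕ x))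

    <∧∣⇒≡ : ∀ {i j} → i ℕ.< Q → j ℕ.< Q → + Q ∣ + i - + j → i ≡ j
    <∧∣⇒≡ {i} {j} i<Q j<Q Q∣i-j = ℕₚ.∣m-n∣≡0⇒m≡n (∣∧<⇒≡0 Q∣∣i-j∣ ∣i-j∣<Q)
      where
      Q∣∣i-j∣ : Q ND.∣ ℕ.∣ i - j ∣
      Q∣∣i-j∣ = subst (Q ND.∣_) (∣+m-+n∣≡∣m-n∣ i j) Q∣i-j
      ∣i-j∣<Q : ℕ.∣ i - j ∣ ℕ.< Q
      ∣i-j∣<Q = ℕₚ.≤-<-trans (ℕₚ.∣m-n∣≤m⊔n i j) (ℕₚ.⊔-lub i<Q j<Q)

    ∃-inverse : ∀ {x} → Coprime Q x → ∃ λ u → + Q ∣ₛ + x * u - 1ℤ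
    ∃-inverse {x} Q⊥x with coprime-Bézout Q⊥x
    ... | Bézout.+- s t 1+tx≡sQ = - + t , divides (- + s) (begin
      + x * - + t - 1ℤ     ≡⟨ rearrange (+ x) (+ t) ⟩
      - (1ℤ + + t * + x)   ≡⟨ cong -_ (1+m*n≡o*p⇒ℤ t x s Q 1+tx≡sQ) ⟩
      - (+ s * + Q)        ≡⟨ ℤₚ.neg-distribˡ-* (+ s) (+ Q) ⟩
      - + s * + Q          ∎)
      where
      rearrange : ∀ x t → x * - t - 1ℤ ≡ - (1ℤ + t * x)
      rearrange = solve-∀
    ... | Bézout.-+ s t 1+sQ≡tx = + t , divides (+ s) (begin
      + x * + t - 1ℤ             ≡⟨ cong (_- 1ℤ) (ℤₚ.*-comm (+ x) (+ t)) ⟩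
      + t * + x - 1ℤ             ≡⟨ cong (_- 1ℤ) (1+m*n≡o*p⇒ℤ s Q t x 1+sQ≡tx) ⟨
      1ℤ + + s * + Q - 1ℤ        ≡⟨ cancel (+ s * + Q) ⟩
      + s * + Q                  ∎)
      where
      cancel : ∀ m → 1ℤ + m - 1ℤ ≡ m
      cancel = solve-∀

    ∃-solution : ∀ {x} → Coprime Q x → ∀ a → ∃ λ (j : Fin Q) → + Q ∣ₛ + x * + toℕ j - a
    ∃-solution {x} Q⊥x a with ∃-inverse Q⊥x
    ... | u , Q∣xu-1 = j , subst (+ Q ∣ₛ_) identity
        (∣m∣n⇒∣m+n (∣n⇒∣m*n (+ x) (∣m⇒∣-m Q∣ua-j)) (∣n⇒∣m*n a Q∣xu-1))
      where
      j : Fin Q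
      j = fromℕ< (n%ℕd<d (u * a) Q)
      Q∣ua-j : + Q ∣ₛ u * a - + toℕ j
      Q∣ua-j = subst (λ r → + Q ∣ₛ u * a - + r) (sym (toℕ-fromℕ< (n%ℕd<d (u * a) Q))) (∣-%ℕ (u * a))
      identity : + x * - (u * a - + toℕ j) + a * (+ x * u - 1ℤ) ≡ + x * + toℕ j - a
      identity = expand (+ x) u a (+ toℕ j)
        where
        expand : ∀ x u a r → x * - (u * a - r) + a * (x * u - 1ℤ) ≡ x * r - a
        expand = solve-∀

    solution-unique : ∀ {x} → Coprime Q x → ∀ a (i j : Fin Q) →
      + Q ∣ₛ + x * + toℕ i - a → + Q ∣ₛ + x * + toℕ j - a → i ≡ j
    solution-unique {x} Q⊥x a i j Q∣xi-a Q∣xj-a =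
      toℕ-injective (<∧∣⇒≡ (toℕ<n i) (toℕ<n j) (coprime-divisor Q⊥x Q∣x∣i-j∣))
      where
      Q∣x[i-j] : + Q ∣ₛ + x * (+ toℕ i - + toℕ j)
      Q∣x[i-j] = subst (+ Q ∣ₛ_) (cancel (+ x) (+ toℕ i) (+ toℕ j) a) (∣m∣n⇒∣m-n Q∣xi-a Q∣xj-a)
        where
        cancel : ∀ x i j a → (x * i - a) - (x * j - a) ≡ x * (i - j)
        cancel = solve-∀
      Q∣x∣i-j∣ : Q ND.∣ x ℕ.* ∣ + toℕ i - + toℕ j ∣
      Q∣x∣i-j∣ = subst (Q ND.∣_) (ℤₚ.abs-* (+ x) (+ toℕ i - + toℕ j)) (∣⇒∣ᵤ Q∣x[i-j])

    toℕ-subMod : ∀ k i → toℕ (subMod Q k i) ≡ (Q ℕ.+ toℕ k ∸ toℕ i) % Q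
    toℕ-subMod k i = toℕ-fromℕ< (m%n<n (Q ℕ.+ toℕ k ∸ toℕ i) Q)

    subMod-involutive : ∀ k i → subMod Q k (subMod Q k i) ≡ i
    subMod-involutive k i = toℕ-injective (begin
      toℕ (subMod Q k (subMod Q k i))
        ≡⟨ toℕ-subMod k (subMod Q k i) ⟩
      (Q ℕ.+ toℕ k ∸ toℕ (subMod Q k i)) % Q
        ≡⟨ cong (λ t → (Q ℕ.+ toℕ k ∸ t) % Q) (toℕ-subMod k i) ⟩
      (Q ℕ.+ toℕ k ∸ (Q ℕ.+ toℕ k ∸ toℕ i) % Q) % Q
        ≡⟨ [m∸[m∸i]%n]%n≡i Q (ℕₚ.m≤m+n Q (toℕ k)) (toℕ<n i) ⟩
      toℕ i
        ∎)

    sum-subMod : ∀ (z : ZC Q) k → sum (z ∘ subMod Q k) ≡ sum z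
    sum-subMod z k = sym (sum-permute z (permutation (subMod Q k) (subMod Q k) inv inv))
      where
      inv : ∀ i → subMod Q k (subMod Q k i) ≡ i
      inv = subMod-involutive k

    normElt-⊛ : ∀ (z : ZC Q) k → (normElt Q ⊛ z) k ≡ sum z
    normElt-⊛ z k = begin
      finSum Q (λ i → 1ℤ * z (subMod Q k i))   ≡⟨ finSum≡sum Q _ ⟩
      sum (λ i → 1ℤ * z (subMod Q k i))        ≡⟨ sum-cong-≗ (ℤₚ.*-identityˡ ∘ z ∘ subMod Q k) ⟩
      sum (z ∘ subMod Q k)                     ≡⟨ sum-subMod z k ⟩
      sum z                                    ∎

    InLZeta⇒∣sum-Q* : ∀ {ℓ} {f : ZC Q} → InLZeta Q ℓ f → ∀ k → + ℓ ∣ₛ sum f - + Q * f k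
    InLZeta⇒∣sum-Q* {ℓ} {f} (y , z , f≡ℓy+Nz) k = divides (sum y - + Q * y k) (begin
      sum f - + Q * f k                                 ≡⟨ cong₂ (λ s t → s - + Q * t) sum-f (f≡ℓy+W k) ⟩
      + ℓ * sum y + + Q * W - + Q * (+ ℓ * y k + W)     ≡⟨ collect (+ ℓ) (+ Q) (sum y) (y k) W ⟩
      (sum y - + Q * y k) * + ℓ                         ∎)
      where
      W : ℤ
      W = sum z
      f≡ℓy+W : ∀ k → f k ≡ + ℓ * y k + W
      f≡ℓy+W k = trans (f≡ℓy+Nz k) (cong (_+_ (+ ℓ * y k)) (normElt-⊛ z k))
      sum-f : sum f ≡ + ℓ * sum y + + Q * W
      sum-f = begin
        sum f                                     ≡⟨ sum-cong-≗ f≡ℓy+W ⟩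
        sum (λ k → + ℓ * y k + W)                 ≡⟨ ∑-distrib-+ (λ k → + ℓ * y k) (λ _ → W) ⟩
        sum (λ k → + ℓ * y k) + sum {Q} (λ _ → W) ≡⟨ cong₂ _+_ (sym (*-distribˡ-sum (+ ℓ) y)) (sum-const Q W) ⟩
        + ℓ * sum y + + Q * W                     ∎
      collect : ∀ l q s t w → l * s + q * w - q * (l * t + w) ≡ (s - q * t) * l
      collect = solve-∀

    onHyperbola : ℤ → Fin Q → Fin Q → Bool
    onHyperbola a x₁ x₂ = ((+ toℕ x₁ * + toℕ x₂ - a) %ℕ Q) ≡ᵇ 0

    trace : ℤ → Fin Q → Fin Q → ℕ
    trace b x₁ x₂ = (b * (+ toℕ x₁ + + toℕ x₂)) %ℕ Q

    contributes : ℤ → ℤ → Fin Q → Fin Q → Fin Q → Bool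
    contributes b a k x₁ x₂ = onHyperbola a x₁ x₂ ∧ (trace b x₁ x₂ ≡ᵇ toℕ k)

    K2≡sum : ∀ b a k → K2 Q b a k ≡ sum λ x₁ → sum λ x₂ → 𝟙 (contributes b a k x₁ x₂)
    K2≡sum b a k = begin
      finSum Q (λ x₁ → finSum Q (λ x₂ → 𝟙 (contributes b a k x₁ x₂)))
        ≡⟨ finSum≡sum Q (λ x₁ → finSum Q (λ x₂ → 𝟙 (contributes b a k x₁ x₂))) ⟩
      sum (λ x₁ → finSum Q (λ x₂ → 𝟙 (contributes b a k x₁ x₂)))
        ≡⟨ sum-cong-≗ (λ x₁ → finSum≡sum Q (λ x₂ → 𝟙 (contributes b a k x₁ x₂))) ⟩
      sum (λ x₁ → sum λ x₂ → 𝟙 (contributes b a k x₁ x₂))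
        ∎

    K2-nonneg : ∀ b a k → 0ℤ ≤ K2 Q b a k
    K2-nonneg b a k = subst (0ℤ ≤_) (sym (K2≡sum b a k))
      (0≤sum _ λ x₁ → 0≤sum _ λ x₂ → 0≤𝟙 (contributes b a k x₁ x₂))
      where
      0≤𝟙 : ∀ c → 0ℤ ≤ 𝟙 c
      0≤𝟙 true  = +≤+ ℕ.z≤n
      0≤𝟙 false = +≤+ ℕ.z≤n

    sum-K2 : ∀ b a → sum (K2 Q b a) ≡ sum λ x₁ → sum λ x₂ → 𝟙 (onHyperbola a x₁ x₂)
    sum-K2 b a = begin
      sum (K2 Q b a)
        ≡⟨ sum-cong-≗ (K2≡sum b a) ⟩
      sum (λ k → sum λ x₁ → sum λ x₂ → 𝟙 (contributes b a k x₁ x₂))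
        ≡⟨ ∑-comm (λ k x₁ → sum λ x₂ → 𝟙 (contributes b a k x₁ x₂)) ⟩
      sum (λ x₁ → sum λ k → sum λ x₂ → 𝟙 (contributes b a k x₁ x₂))
        ≡⟨ sum-cong-≗ (λ x₁ → ∑-comm (λ k x₂ → 𝟙 (contributes b a k x₁ x₂))) ⟩
      sum (λ x₁ → sum λ x₂ → sum λ k → 𝟙 (contributes b a k x₁ x₂))
        ≡⟨ sum-cong-≗ (λ x₁ → sum-cong-≗ λ x₂ →
             sum-𝟙-∧ {Q} (onHyperbola a x₁ x₂) (λ k → trace b x₁ x₂ ≡ᵇ toℕ k)
               (sum-𝟙-≡ᵇ {Q} (n%ℕd<d (b * (+ toℕ x₁ + + toℕ x₂)) Q))) ⟩
      sum (λ x₁ → sum λ x₂ → 𝟙 (onHyperbola a x₁ x₂))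
        ∎

    row-count : ∀ {x₁ : Fin Q} → Coprime Q (toℕ x₁) → ∀ a → sum (𝟙 ∘ onHyperbola a x₁) ≡ 1ℤ
    row-count {x₁} Q⊥x a =
      let j , Q∣xj-a = ∃-solution Q⊥x a in
      sum-𝟙-unique (onHyperbola a x₁) (∣⇒T[%ℕ≡ᵇ0] (+ toℕ x₁ * + toℕ j - a) Q∣xj-a)
        (λ i hi → solution-unique Q⊥x a i j (T[%ℕ≡ᵇ0]⇒∣ (+ toℕ x₁ * + toℕ i - a) hi) Q∣xj-a)

  hyperbola-count : ∀ {n} → Prime (suc n) → ∀ {a} → ¬ + suc n ∣ₛ a →
    sum (λ x₁ → sum λ x₂ → 𝟙 (onHyperbola {suc n} a x₁ x₂)) ≡ + n
  hyperbola-count {n} pQ {a} Q∤a = begin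
    sum (𝟙 ∘ onHyperbola {suc n} a zero) + sum (λ i → sum (𝟙 ∘ onHyperbola {suc n} a (suc i)))
      ≡⟨ cong₂ _+_ (sum-𝟙-none (onHyperbola a zero) no-solution)
                   (sum-cong-≗ λ i → row-count {x₁ = suc i} (Q⊥ i) a) ⟩
    0ℤ + sum {n} (λ _ → 1ℤ)   ≡⟨ ℤₚ.+-identityˡ _ ⟩
    sum {n} (λ _ → 1ℤ)        ≡⟨ sum-const n 1ℤ ⟩
    + n * 1ℤ                  ≡⟨ ℤₚ.*-identityʳ (+ n) ⟩
    + n                       ∎
    where
    no-solution : ∀ x₂ → ¬ T (onHyperbola a zero x₂)
    no-solution x₂ h = Q∤a (subst (+ suc n ∣ₛ_) (ℤₚ.neg-involutive a)
      (∣m⇒∣-m (subst (+ suc n ∣ₛ_) (ℤₚ.+-identityˡ (- a)) (T[%ℕ≡ᵇ0]⇒∣ (0ℤ - a) h))))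
    Q⊥ : ∀ (i : Fin n) → Coprime (suc n) (suc (toℕ i))
    Q⊥ i = prime⇒coprime pQ (toℕ<n (suc i))

  sum-K2≡n : ∀ {n} → Prime (suc n) → ∀ b {a} → ¬ + suc n ∣ₛ a → sum (K2 (suc n) b a) ≡ + n
  sum-K2≡n pQ b {a} Q∤a = trans (sum-K2 b a) (hyperbola-count pQ Q∤a)

  K2-has-zero : ∀ {n} → Prime (suc n) → ∀ b {a} → ¬ + suc n ∣ₛ a → ∃ λ k → K2 (suc n) b a k ≡ 0ℤ
  K2-has-zero {n} pQ b {a} Q∤a = sum<n⇒∃≡0 (K2 (suc n) b a) (K2-nonneg b a)
    (subst (_< + suc n) (sym (sum-K2≡n pQ b Q∤a)) (ℤ.+<+ (ℕₚ.n<1+n n)))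

  K2∈ℓℤ[ζ]⇒ℓ∣Q-1 : ∀ ℓ {n} → Prime (suc n) → ∀ b {a} → ¬ + suc n ∣ₛ a →
    InLZeta (suc n) ℓ (K2 (suc n) b a) → ℓ ND.∣ n
  K2∈ℓℤ[ζ]⇒ℓ∣Q-1 ℓ {n} pQ b {a} Q∤a K∈ℓℤ[ζ] =
    ∣⇒∣ᵤ (subst (+ ℓ ∣ₛ_) sum-Q*Kk≡n (InLZeta⇒∣sum-Q* K∈ℓℤ[ζ] k))
    where
    k : Fin (suc n)
    k = proj₁ (K2-has-zero pQ b Q∤a)
    Kk≡0 : K2 (suc n) b a k ≡ 0ℤ
    Kk≡0 = proj₂ (K2-has-zero pQ b Q∤a)
    sum-Q*Kk≡n : sum (K2 (suc n) b a) - + suc n * K2 (suc n) b a k ≡ + n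
    sum-Q*Kk≡n = begin
      sum (K2 (suc n) b a) - + suc n * K2 (suc n) b a k
        ≡⟨ cong₂ (λ s t → s - + suc n * t) (sum-K2≡n pQ b Q∤a) Kk≡0 ⟩
      + n - + suc n * 0ℤ    ≡⟨ cong (_-_ (+ n)) (ℤₚ.*-zeroʳ (+ suc n)) ⟩
      + n - 0ℤ              ≡⟨ ℤₚ.+-identityʳ (+ n) ⟩
      + n                   ∎

open Lemmas using (K2∈ℓℤ[ζ]⇒ℓ∣Q-1)

open import Defs
open import Data.Nat using (ℕ; _≥_; _+_; _∸_; NonZero)
open import Data.Nat.Primality using (Prime)
open import Data.Integer using (ℤ; +_; _*_)
open import Data.Integer.Divisibility using (_∣_)
open import Data.Sum using (_⊎_)
open import Relation.Nullary using (¬_)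
open import Relation.Binary.PropositionalEquality using (_≢_)
import Data.Nat.Divisibility as ND

open import Data.Nat using (suc)
open import Data.Sum using (inj₁)
open import Data.Integer.Divisibility.Signed using (∣⇒∣ᵤ; ∣m⇒∣m*n) renaming (_∣_ to _∣ₛ_)

lemma5p2 : (ℓ Q : ℕ) .{{_ : NonZero Q}} → Prime ℓ → Prime Q → ℓ ≥ 5 → Q ≥ 5 → ℓ ≢ Q →
    (a₀ b₀ : ℤ) → ¬ ((+ Q) ∣ (a₀ * b₀)) →
    InLZeta Q ℓ (K2 Q b₀ a₀) →
    (ℓ ND.∣ (Q ∸ 1)) ⊎ (ℓ ND.∣ (Q + 1))
lemma5p2 ℓ (suc n) _ pQ _ _ _ a₀ b₀ Q∤a₀b₀ K∈ℓℤ[ζ] =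
  inj₁ (K2∈ℓℤ[ζ]⇒ℓ∣Q-1 ℓ pQ b₀ Q∤a₀ K∈ℓℤ[ζ])
  where
  Q∤a₀ : ¬ + suc n ∣ₛ a₀
  Q∤a₀ Q∣a₀ = Q∤a₀b₀ (∣⇒∣ᵤ (∣m⇒∣m*n b₀ Q∣a₀))
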